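{- Let $d$ be a positive integer and $\preceq$ a relaxed monomial order on $\mathbb{N}^d$. Let $\mathcal{T}^{\operatorname{R}}_{d,\preceq}$ be the oriented graph whose vertex set is $\operatorname{R}_\preceq(\mathcal{S}_d)$ and in which $(S,T)$ is an edge if and only if $S\neq\mathbb{N}^d$ and $T=S\cup\{\mathbf{F}_\preceq(S)\}$. Then: (1) $\mathcal{T}^{\operatorname{R}}_{d,\preceq}$ is a tree whose root is $\mathbb{N}^d$; (2) for every positive integer $g$, $S\in\operatorname{R}_\preceq(\mathcal{S}_{g,d})$ if and only if $S$ is a vertex of depth $g$ in $\mathcal{T}^{\operatorname{R}}_{d,\preceq}$; (3) for every $S\in\operatorname{R}_\preceq(\mathcal{S}_d)$, the children of $S$ in $\mathcal{T}^{\operatorname{R}}_{d,\preceq}$ are exactly the GNSs $S\setminus\{\mathbf{n}\}$ such that $\mathbf{n}\in\mathbf{U}_\preceq(S)$ and $S\setminus\{\mathbf{n}\}\in\operatorname{R}_\preceq(\mathcal{S}_d)$.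
   Context: A generalized numerical semigroup (GNS) in $\mathbb{N}^d$ is a submonoid $S$ of $(\mathbb{N}^d,+)$ with $\operatorname{H}(S)=\mathbb{N}^d\setminus S$ finite; $\operatorname{g}(S)=|\operatorname{H}(S)|$ is its genus. $\mathcal{S}_d$ is the set of GNSs in $\mathbb{N}^d$ and $\mathcal{S}_{g,d}$ those of genus $g$. $\operatorname{A}(S)$ is the minimal generating set $S^*\setminus(S^*+S^*)$, $S^*=S\setminus\{\mathbf{0}\}$. $\operatorname{P}_d$ is the set of permutations of $\{1,\ldots,d\}$; with standard basis $\mathbf{e}_1,\ldots,\mathbf{e}_d$, $\sigma(\sum x_i\mathbf{e}_i)=\sum x_i\mathbf{e}_{\sigma(i)}$ and $\sigma(A)=\{\sigma(\mathbf{a}):\mathbf{a}\in A\}$; $[S]_\simeq=\{\sigma(S)\mid\sigma\in\operatorname{P}_d\}$ (the GNSs isomorphic to $S$, all of the same genus). A relaxed monomial order is a total order $\preceq$ on $\mathbb{N}^d$ with $\mathbf{0}\preceq\mathbf{v}$ for all $\mathbf{v}$ and such that $\mathbf{v}\prec\mathbf{w}$ implies $\mathbf{v}\prec\mathbf{w}+\mathbf{u}$ for all $\mathbf{u}\in\mathbb{N}^d$. $\mathbf{F}_\preceq(S)=\max_\preceq\operatorname{H}(S)$ (convention $\mathbf{F}_\preceq(\mathbb{N}^d)=(-1,\ldots,-1)$, preceding everything) and $\mathbf{U}_\preceq(S)=\{\mathbf{x}\in\operatorname{A}(S)\mid\mathbf{F}_\preceq(S)\prec\mathbf{x}\}$.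 For $S,S'\in\mathcal{S}_{g,d}$ with $\operatorname{H}(S)=\{\mathbf{h}_1\prec\cdots\prec\mathbf{h}_g\}$, $\operatorname{H}(S')=\{\mathbf{h}'_1\prec\cdots\prec\mathbf{h}'_g\}$, define $S\preceq_{\operatorname{R}}S'$ if $S=S'$ or $\mathbf{h}_r\prec\mathbf{h}'_r$ where $r=\min\{i\mid\mathbf{h}_i\neq\mathbf{h}'_i\}$; this is a total order on $\mathcal{S}_{g,d}$. $\operatorname{R}_\preceq(S)=\min_{\preceq_{\operatorname{R}}}[S]_\simeq$, $\operatorname{R}_\preceq(\mathcal{S}_d)=\{\operatorname{R}_\preceq(S)\mid S\in\mathcal{S}_d\}$, $\operatorname{R}_\preceq(\mathcal{S}_{g,d})=\{\operatorname{R}_\preceq(S)\mid S\in\mathcal{S}_{g,d}\}$. An oriented graph is a tree with root $\mathbf{v}$ if every vertex $\mathbf{x}$ has a unique path (distinct vertices joined by directed edges) from $\mathbf{x}$ to $\mathbf{v}$; the length of this path is the depth of $\mathbf{x}$; if $(\mathbf{x},\mathbf{y})$ is an edge, $\mathbf{x}$ is a child of $\mathbf{y}$. -}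

module Defs where

open import Data.Nat using (ℕ; zero; suc; _+_)
import Data.Nat as ℕ
open import Data.Bool using (Bool; true; false; _∨_; _∧_; not)
open import Data.Fin using (Fin)
open import Data.Vec using (Vec; replicate; zipWith; tabulate; lookup)
open import Data.Vec.Properties using (≡-dec)
open import Data.List using (List; []; _∷_; length)
open import Data.List.Membership.Propositional using (_∈_)
open import Data.List.Relation.Unary.Unique.Propositional using (Unique)
open import Data.List.Relation.Unary.Linked using (Linked)
open import Data.List.Relation.Unary.AllPairs using (AllPairs)
open import Data.List.Relation.Binary.Pointwise using (Pointwise)
open import Data.Maybe using (Maybe; just; nothing)
open import Data.Product using (Σ; _×_; ∃; ∃-syntax; _,_)
open import Data.Sum using (_⊎_)
open import Data.Empty using (⊥)
open import Data.Unit using (⊤)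
open import Data.Fin.Permutation using (Permutation′; _⟨$⟩ʳ_; _⟨$⟩ˡ_)
open import Relation.Nullary using (¬_)
open import Relation.Nullary.Decidable using (⌊_⌋)
open import Relation.Binary.PropositionalEquality using (_≡_; _≢_)
open import Relation.Binary.Structures using (IsTotalOrder)
open import Function.Bundles using (_⇔_)

Pt : ℕ → Set
Pt d = Vec ℕ d

𝟎 : ∀ {d} → Pt d
𝟎 {d} = replicate d 0

infixl 6 _⊕_
_⊕_ : ∀ {d} → Pt d → Pt d → Pt d
_⊕_ = zipWith _+_

_≟ₚ_ : ∀ {d} (x y : Pt d) → _
_≟ₚ_ = ≡-dec ℕ._≟_

Subset : ℕ → Set
Subset d = Pt d → Bool

infix 4 _≐_
_≐_ : ∀ {d} → Subset d → Subset d → Set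
S ≐ T = ∀ x → S x ≡ T x

Full : ∀ d → Subset d
Full d _ = true

_∪｛_｝ : ∀ {d} → Subset d → Pt d → Subset d
(S ∪｛ f ｝) x = S x ∨ ⌊ x ≟ₚ f ⌋

_∖｛_｝ : ∀ {d} → Subset d → Pt d → Subset d
(S ∖｛ n ｝) x = S x ∧ not ⌊ x ≟ₚ n ⌋

Enumerates : ∀ {d} → Subset d → List (Pt d) → Set
Enumerates S hs = ∀ x → (S x ≡ false) ⇔ (x ∈ hs)

record IsGNS {d} (S : Subset d) : Set where
  field
    zero∈ : S 𝟎 ≡ true
    closed : ∀ x y → S x ≡ true → S y ≡ true → S (x ⊕ y) ≡ true
    finiteHoles : Σ (List (Pt d)) (Enumerates S)

HasGenus : ∀ {d} → Subset d → ℕ → Set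
HasGenus S g = Σ _ λ hs → Enumerates S hs × Unique hs × length hs ≡ g

Nonzero∈ : ∀ {d} → Subset d → Pt d → Set
Nonzero∈ S x = S x ≡ true × x ≢ 𝟎

Atom : ∀ {d} → Subset d → Pt d → Set
Atom S x = Nonzero∈ S x ×
  ¬ (Σ _ λ a → Σ _ λ b → Nonzero∈ S a × Nonzero∈ S b × x ≡ a ⊕ b)

-- Permutations: σ(Σ xᵢ eᵢ) = Σ xᵢ e_{σ(i)}, i.e. σ(x)_{σ(i)} = x_i

actPt : ∀ {d} → Permutation′ d → Pt d → Pt d
actPt σ x = tabulate (λ j → lookup x (σ ⟨$⟩ˡ j))

actPt⁻¹ : ∀ {d} → Permutation′ d → Pt d → Pt d
actPt⁻¹ σ y = tabulate (λ i → lookup y (σ ⟨$⟩ʳ i))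

-- σ(S) = { σ(a) | a ∈ S } : y ∈ σ(S) iff σ⁻¹(y) ∈ S
actSub : ∀ {d} → Permutation′ d → Subset d → Subset d
actSub σ S y = S (actPt⁻¹ σ y)

record RelaxedMonomialOrder (d : ℕ) : Set₁ where
  field
    _≼_ : Pt d → Pt d → Set
    isTotalOrder : IsTotalOrder _≡_ _≼_
    zero-least : ∀ v → 𝟎 ≼ v

  _≺_ : Pt d → Pt d → Set
  v ≺ w = v ≼ w × v ≢ w

  field
    ≺-compat : ∀ v w u → v ≺ w → v ≺ (w ⊕ u)

module WithOrder {d : ℕ} (O : RelaxedMonomialOrder d) where
  open RelaxedMonomialOrder O

  -- F_≼(S) ∈ Pt d ∪ {(-1,…,-1)}; `nothing` stands for (-1,…,-1).
  IsFrobenius : Subset d → Maybe (Pt d) → Set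
  IsFrobenius S nothing  = ∀ x → S x ≡ true
  IsFrobenius S (just f) = S f ≡ false × (∀ h → S h ≡ false → h ≼ f)

  _≺ₘ_ : Maybe (Pt d) → Pt d → Set
  nothing ≺ₘ x = ⊤
  just f  ≺ₘ x = f ≺ x

  InU : Subset d → Pt d → Set
  InU S x = Atom S x × Σ _ λ f → IsFrobenius S f × f ≺ₘ x

  SortedHoles : Subset d → List (Pt d) → Set
  SortedHoles S hs = Linked _≺_ hs × Enumerates S hs

  data LexLt : List (Pt d) → List (Pt d) → Set where
    here  : ∀ {x y xs ys} → x ≺ y → LexLt (x ∷ xs) (y ∷ ys)
    there : ∀ {x xs ys} → LexLt xs ys → LexLt (x ∷ xs) (x ∷ ys)

  _≼R_ : Subset d → Subset d → Set
  S ≼R S' = S ≐ S' ⊎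
    (Σ _ λ hs → Σ _ λ hs' → SortedHoles S hs × SortedHoles S' hs' × LexLt hs hs')

  Isomorphic : Subset d → Subset d → Set
  Isomorphic S T = Σ (Permutation′ d) λ σ → T ≐ actSub σ S

  IsRmin : Subset d → Subset d → Set
  IsRmin S T = Isomorphic S T × (∀ σ → T ≼R actSub σ S)

  InRSd : Subset d → Set
  InRSd T = Σ (Subset d) λ S → IsGNS S × IsRmin S T

  InRSgd : ℕ → Subset d → Set
  InRSgd g T = Σ (Subset d) λ S → IsGNS S × HasGenus S g × IsRmin S T

  Vertex : Subset d → Set
  Vertex = InRSd

  Edge : Subset d → Subset d → Set
  Edge S T = ¬ (S ≐ Full d) × Σ _ λ f → IsFrobenius S (just f) × T ≐ (S ∪｛ f ｝)

-- Oriented graphs on subsets of ℕ^d (vertices identified up to ≐)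

module Graph {d : ℕ} (V : Subset d → Set) (E : Subset d → Subset d → Set) where

  data Walk : Subset d → Subset d → Set where
    stop : ∀ {x y} → V x → x ≐ y → Walk x y
    step : ∀ {x z y} → V x → E x z → Walk z y → Walk x y

  verts : ∀ {x y} → Walk x y → List (Subset d)
  verts (stop {x} _ _) = x ∷ []
  verts (step {x} _ _ w) = x ∷ verts w

  edges : ∀ {x y} → Walk x y → ℕ
  edges (stop _ _) = 0
  edges (step _ _ w) = suc (edges w)

  Path : Subset d → Subset d → Set
  Path x y = Σ (Walk x y) λ w → AllPairs (λ a b → ¬ (a ≐ b)) (verts w)

  IsTreeWithRoot : Subset d → Set
  IsTreeWithRoot r = V r × (∀ x → V x →
      Path x r × (∀ (p q : Path x r) →
        Pointwise _≐_ (verts (Data.Product.proj₁ p)) (verts (Data.Product.proj₁ q))))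

  HasDepth : Subset d → Subset d → ℕ → Set
  HasDepth r x k = Σ (Path x r) λ p → edges (Data.Product.proj₁ p) ≡ k

{-# OPTIONS --safe #-}

-- Let F be the Frobenius element of a GNS S ≠ ℕ^d. Since F ≺ F + y for y ≠ 0, all such points
-- lie in S, so S ∪ {F} is closed under addition: a GNS of genus one less. The heart of the proof
-- is that S ∪ {F} stays ≼_R-minimal in its isomorphism class when S is. The sorted holes of S
-- are those of S ∪ {F} followed by F; the sorted holes of σ(S) are those of σ(S ∪ {F}) with
-- σ(F) inserted; and if B precedes A lexicographically, then B with any new element inserted
-- precedes A followed by F. So σ(S ∪ {F}) ≺_R S ∪ {F} would force σ(S) ≺_R S.
-- Hence each vertex of genus g has exactly one outgoing edge (the Frobenius element is unique),
-- leading to a vertex of genus g − 1, and ℕ^d is reached after g steps. Conversely, T → S is an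
-- edge exactly when T = S ∖ {n}, where n = F(T) is an atom of S beyond F(S).

module Submission where

open import Defs
open import Data.Nat using (ℕ; zero; suc; _+_; _≤_)
import Data.Nat.Properties as ℕ
open import Data.Bool using (true; false; _∨_; _∧_; not)
open import Data.Bool.Properties using (∨-zeroʳ; ∨-identityʳ; ∧-zeroʳ; ∧-identityʳ; ¬-not)
open import Data.Empty using (⊥-elim)
open import Data.Fin using (Fin)
open import Data.Fin.Permutation as Perm using (Permutation′)
open import Data.List using (List; []; _∷_; _++_; _∷ʳ_; length; map; filter; deduplicate)
open import Data.List.Properties using (length-map)
open import Data.List.Membership.Propositional using (_∈_; _∉_)
open import Data.List.Membership.Propositional.Properties
  using (∈-map⁺; ∈-map⁻; ∈-filter⁺; ∈-filter⁻; deduplicate-∈⇔)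
open import Data.List.Membership.Propositional.Properties.WithK using (unique∧set⇒bag)
open import Data.List.Relation.Binary.BagAndSetEquality using (∼bag⇒↭)
open import Data.List.Relation.Binary.Permutation.Propositional using (_↭_; ↭-sym; ↭⇒↭ₛ)
open import Data.List.Relation.Binary.Permutation.Propositional.Properties using (↭-length; ∈-resp-↭)
import Data.List.Relation.Binary.Permutation.Setoid.Properties as PermutationₛProperties
open import Data.List.Relation.Binary.Pointwise using (Pointwise; []; _∷_; Pointwise-≡⇒≡)
open import Data.List.Relation.Unary.All as All using (All; []; _∷_)
open import Data.List.Relation.Unary.All.Properties using (¬Any⇒All¬)
open import Data.List.Relation.Unary.AllPairs as AllPairs using ([]; _∷_)
open import Data.List.Relation.Unary.Any using (here; there)
open import Data.List.Relation.Unary.Linked as Linked using (Linked)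
open import Data.List.Relation.Unary.Linked.Properties using (Linked⇒AllPairs; AllPairs⇒Linked)
open import Data.List.Relation.Unary.Unique.Propositional using (Unique)
import Data.List.Relation.Unary.Unique.Propositional.Properties as Unique
open import Data.List.Relation.Unary.Unique.DecPropositional.Properties using (deduplicate-!)
open import Data.Maybe using (Maybe; just; nothing)
open import Data.Product as Product using (Σ; ∃; _×_; _,_; proj₁; proj₂)
open import Data.Sum as Sum using (_⊎_; inj₁; inj₂)
open import Data.Unit using (tt)
open import Data.Vec using ([]; _∷_; tabulate; lookup)
import Data.Vec.Properties as Vec
open import Function using (_∘_; id; case_of_; _⇔_; mk⇔; Equivalence)
import Function.Properties.Equivalence as ⇔
open import Relation.Binary using (DecTotalOrder; IsStrictTotalOrder; IsTotalOrder; Tri)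
open import Relation.Binary.Consequences using (total∧dec⇒dec)
open import Relation.Binary.Construct.NonStrictToStrict using (<-isStrictTotalOrder₁)
open import Relation.Binary.PropositionalEquality
open import Relation.Nullary using (¬_; yes; no; ¬?; does)
open import Relation.Nullary.Decidable using (⌊_⌋; isYes≗does; dec-true; dec-false; does-⇔)

open Equivalence using (to; from)

private variable
  d k g : ℕ
  S T U S' T' : Subset d
  f n : Pt d
  hs xs ys : List (Pt d)

-- Points of ℕ^d and the permutation action

⊕-comm : (x y : Pt d) → x ⊕ y ≡ y ⊕ x
⊕-comm = Vec.zipWith-comm ℕ.+-comm

⊕-cancelˡ : (x y : Pt d) → x ⊕ y ≡ x → y ≡ 𝟎
⊕-cancelˡ [] [] _ = refl
⊕-cancelˡ (a ∷ x) (b ∷ y) eq =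
  cong₂ _∷_ (ℕ.+-cancelˡ-≡ a b 0 (trans (Vec.∷-injectiveˡ eq) (sym (ℕ.+-identityʳ a))))
            (⊕-cancelˡ x y (Vec.∷-injectiveʳ eq))

reindex : (Fin d → Fin d) → Pt d → Pt d
reindex π x = tabulate (lookup x ∘ π)

tabulate-≗-lookup : ∀ {f : Fin d → ℕ} x → f ≗ lookup x → tabulate f ≡ x
tabulate-≗-lookup x f≗x = trans (Vec.tabulate-cong f≗x) (Vec.tabulate∘lookup x)

reindex-𝟎 : ∀ π → reindex π 𝟎 ≡ 𝟎 {d}
reindex-𝟎 π = tabulate-≗-lookup 𝟎 λ i →
  trans (Vec.lookup-replicate (π i) 0) (sym (Vec.lookup-replicate i 0))

reindex-⊕ : ∀ π (x y : Pt d) → reindex π (x ⊕ y) ≡ reindex π x ⊕ reindex π y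
reindex-⊕ π x y = tabulate-≗-lookup _ λ i → begin
  lookup (x ⊕ y) (π i)
    ≡⟨ Vec.lookup-zipWith _+_ (π i) x y ⟩
  lookup x (π i) + lookup y (π i)
    ≡⟨ cong₂ _+_ (Vec.lookup∘tabulate _ i) (Vec.lookup∘tabulate _ i) ⟨
  lookup (reindex π x) i + lookup (reindex π y) i
    ≡⟨ Vec.lookup-zipWith _+_ i (reindex π x) (reindex π y) ⟨
  lookup (reindex π x ⊕ reindex π y) i
    ∎
  where open ≡-Reasoning

reindex-∘ : ∀ π ρ (x : Pt d) → reindex π (reindex ρ x) ≡ reindex (ρ ∘ π) x
reindex-∘ π ρ x = Vec.tabulate-cong λ i → Vec.lookup∘tabulate _ (π i)

reindex-id : ∀ {π : Fin d → Fin d} → π ≗ id → ∀ x → reindex π x ≡ x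
reindex-id π≗id x = tabulate-≗-lookup x λ i → cong (lookup x) (π≗id i)

actPt⁻¹-actPt : ∀ (σ : Permutation′ d) x → actPt⁻¹ σ (actPt σ x) ≡ x
actPt⁻¹-actPt σ x = trans (reindex-∘ _ _ x) (reindex-id (λ _ → Perm.inverseˡ σ) x)

actPt-actPt⁻¹ : ∀ (σ : Permutation′ d) y → actPt σ (actPt⁻¹ σ y) ≡ y
actPt-actPt⁻¹ σ y = trans (reindex-∘ _ _ y) (reindex-id (λ _ → Perm.inverseʳ σ) y)

-- Subsets

≐-refl : S ≐ S
≐-refl _ = refl

≐-sym : S ≐ T → T ≐ S
≐-sym S≐T x = sym (S≐T x)

≐-trans : S ≐ T → T ≐ U → S ≐ U
≐-trans S≐T T≐U x = trans (S≐T x) (T≐U x)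

⌊≟⌋-diag : (x : Pt d) → ⌊ x ≟ₚ x ⌋ ≡ true
⌊≟⌋-diag x = trans (isYes≗does (x ≟ₚ x)) (dec-true (x ≟ₚ x) refl)

⌊≟⌋-off : {x y : Pt d} → x ≢ y → ⌊ x ≟ₚ y ⌋ ≡ false
⌊≟⌋-off {x = x} {y} x≢y = trans (isYes≗does (x ≟ₚ y)) (dec-false (x ≟ₚ y) x≢y)

_⊆ₛ_ : Subset d → Subset d → Set
S ⊆ₛ T = ∀ x → S x ≡ true → T x ≡ true

∪-self : (S : Subset d) (f : Pt d) → (S ∪｛ f ｝) f ≡ true
∪-self S f = trans (cong (S f ∨_) (⌊≟⌋-diag f)) (∨-zeroʳ (S f))

∪-other : (S : Subset d) {f x : Pt d} → x ≢ f → (S ∪｛ f ｝) x ≡ S x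
∪-other S {f} {x} x≢f = trans (cong (S x ∨_) (⌊≟⌋-off x≢f)) (∨-identityʳ (S x))

∪-⊇ : (S : Subset d) {f x : Pt d} → S x ≡ true → (S ∪｛ f ｝) x ≡ true
∪-⊇ S {f} {x} Sx = cong (_∨ ⌊ x ≟ₚ f ⌋) Sx

∪-hole : (S : Subset d) {f x : Pt d} → (S ∪｛ f ｝) x ≡ false → S x ≡ false × x ≢ f
∪-hole S {f} {x} S∪fx = trans (sym (∪-other S x≢f)) S∪fx , x≢f
  where
  x≢f : x ≢ f
  x≢f refl = case trans (sym (∪-self S f)) S∪fx of λ ()

∪-member : (S : Subset d) {f x : Pt d} → (S ∪｛ f ｝) x ≡ true → S x ≡ true ⊎ x ≡ f
∪-member S {f} {x} S∪fx = case x ≟ₚ f of λ where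
  (yes x≡f) → inj₂ x≡f
  (no x≢f) → inj₁ (trans (sym (∪-other S x≢f)) S∪fx)

∖-self : (S : Subset d) (n : Pt d) → (S ∖｛ n ｝) n ≡ false
∖-self S n = trans (cong (λ b → S n ∧ not b) (⌊≟⌋-diag n)) (∧-zeroʳ (S n))

∖-other : (S : Subset d) {n x : Pt d} → x ≢ n → (S ∖｛ n ｝) x ≡ S x
∖-other S {n} {x} x≢n = trans (cong (λ b → S x ∧ not b) (⌊≟⌋-off x≢n)) (∧-identityʳ (S x))

≐-at-and-off : (S T : Subset d) (f : Pt d) → S f ≡ T f → (∀ {x} → x ≢ f → S x ≡ T x) → S ≐ T
≐-at-and-off S T f at off x with x ≟ₚ f
... | yes refl = at
... | no x≢f = off x≢f

≐-∖-of-∪ : T f ≡ false → S ≐ T ∪｛ f ｝ → T ≐ S ∖｛ f ｝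
≐-∖-of-∪ {T = T} {f = f} {S = S} Tf S≐ = ≐-at-and-off T (S ∖｛ f ｝) f
  (trans Tf (sym (∖-self S f)))
  (λ x≢f → sym (trans (∖-other S x≢f) (trans (S≐ _) (∪-other T x≢f))))

≐-∪-of-∖ : S n ≡ true → T ≐ S ∖｛ n ｝ → S ≐ T ∪｛ n ｝
≐-∪-of-∖ {S = S} {n = n} {T = T} Sn T≐ = ≐-at-and-off S (T ∪｛ n ｝) n
  (trans Sn (sym (∪-self T n)))
  (λ x≢n → sym (trans (∪-other T x≢n) (trans (T≐ _) (∖-other S x≢n))))

actSub-∘ₚ : ∀ (S : Subset d) σ τ → actSub σ (actSub τ S) ≐ actSub (τ Perm.∘ₚ σ) S
actSub-∘ₚ S σ τ y = cong S (reindex-∘ _ _ y)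

actSub-id : (S : Subset d) → S ≐ actSub Perm.id S
actSub-id S y = cong S (sym (reindex-id (λ _ → refl) y))

actSub-∪ : ∀ (S : Subset d) σ (f : Pt d) → actSub σ (S ∪｛ f ｝) ≐ actSub σ S ∪｛ actPt σ f ｝
actSub-∪ S σ f y = cong (S (actPt⁻¹ σ y) ∨_) (begin
  ⌊ actPt⁻¹ σ y ≟ₚ f ⌋        ≡⟨ isYes≗does (actPt⁻¹ σ y ≟ₚ f) ⟩
  does (actPt⁻¹ σ y ≟ₚ f)     ≡⟨ does-⇔ moved (actPt⁻¹ σ y ≟ₚ f) (y ≟ₚ actPt σ f) ⟩
  does (y ≟ₚ actPt σ f)       ≡⟨ isYes≗does (y ≟ₚ actPt σ f) ⟨
  ⌊ y ≟ₚ actPt σ f ⌋          ∎)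
  where
  open ≡-Reasoning
  moved : actPt⁻¹ σ y ≡ f ⇔ y ≡ actPt σ f
  moved = mk⇔ (λ eq → trans (sym (actPt-actPt⁻¹ σ y)) (cong (actPt σ) eq))
              (λ eq → trans (cong (actPt⁻¹ σ) eq) (actPt⁻¹-actPt σ f))

-- Hole enumerations and the genus

Enumerates-resp : S ≐ T → Enumerates S hs → Enumerates T hs
Enumerates-resp S≐T en x =
  mk⇔ (λ Tx → to (en x) (trans (S≐T x) Tx)) (λ x∈ → trans (sym (S≐T x)) (from (en x) x∈))

Enumerates-resp-∈ : Enumerates S xs → (∀ {x} → x ∈ xs ⇔ x ∈ ys) → Enumerates S ys
Enumerates-resp-∈ en xs≈ys x = ⇔.trans (en x) xs≈ys

Enumerates-resp-↭ : Enumerates S xs → xs ↭ ys → Enumerates S ys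
Enumerates-resp-↭ en xs↭ys = Enumerates-resp-∈ en (mk⇔ (∈-resp-↭ xs↭ys) (∈-resp-↭ (↭-sym xs↭ys)))

Enumerates-≐ : Enumerates S hs → Enumerates T hs → S ≐ T
Enumerates-≐ {S = S} {T = T} enS enT x with S x in Sx | T x in Tx
... | true  | true  = refl
... | false | false = refl
... | true  | false = trans (sym Sx) (from (enS x) (to (enT x) Tx))
... | false | true  = trans (sym (from (enT x) (to (enS x) Sx))) Tx

Enumerates-↭ : Enumerates S xs → Enumerates S ys → Unique xs → Unique ys → xs ↭ ys
Enumerates-↭ enx eny ux uy = ∼bag⇒↭ (unique∧set⇒bag ux uy λ {x} → ⇔.trans (⇔.sym (enx x)) (eny x))

Enumerates-act : ∀ σ → Enumerates S hs → Enumerates (actSub σ S) (map (actPt σ) hs)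
Enumerates-act {S = S} {hs = hs} σ en y = mk⇔
  (λ Sσ⁻¹y → subst (_∈ map (actPt σ) hs) (actPt-actPt⁻¹ σ y) (∈-map⁺ (actPt σ) (to (en _) Sσ⁻¹y)))
  (λ y∈ → let x , x∈ , y≡σx = ∈-map⁻ (actPt σ) y∈ in
    trans (cong S (trans (cong (actPt⁻¹ σ) y≡σx) (actPt⁻¹-actPt σ x))) (from (en x) x∈))

Enumerates-∪ : Enumerates S hs → Enumerates (S ∪｛ f ｝) (filter (λ h → ¬? (h ≟ₚ f)) hs)
Enumerates-∪ {S = S} {f = f} en x = mk⇔
  (λ S∪fx → let Sx , x≢f = ∪-hole S S∪fx in ∈-filter⁺ (λ h → ¬? (h ≟ₚ f)) (to (en x) Sx) x≢f)
  (λ x∈ → let x∈hs , x≢f = ∈-filter⁻ (λ h → ¬? (h ≟ₚ f)) x∈ in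
    trans (∪-other S x≢f) (from (en x) x∈hs))

hole-∉ : Enumerates (S ∪｛ f ｝) hs → f ∉ hs
hole-∉ {S = S} {f = f} en f∈ = case trans (sym (∪-self S f)) (from (en f) f∈) of λ ()

Enumerates-∷ : S f ≡ false → Enumerates (S ∪｛ f ｝) hs → Enumerates S (f ∷ hs)
Enumerates-∷ {S = S} {f = f} Sf en x with x ≟ₚ f
... | yes refl = mk⇔ (λ _ → here refl) (λ _ → Sf)
... | no x≢f = mk⇔ (λ Sx → there (to (en x) (trans (∪-other S x≢f) Sx))) λ where
  (here refl) → ⊥-elim (x≢f refl)
  (there x∈) → proj₁ (∪-hole S (from (en x) x∈))

-- Generalized numerical semigroups and their genus

IsGNS-resp : S ≐ T → IsGNS S → IsGNS T
IsGNS-resp S≐T G = record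
  { zero∈ = trans (sym (S≐T 𝟎)) zero∈
  ; closed = λ x y Tx Ty → trans (sym (S≐T _)) (closed x y (trans (S≐T x) Tx) (trans (S≐T y) Ty))
  ; finiteHoles = proj₁ finiteHoles , Enumerates-resp S≐T (proj₂ finiteHoles)
  }
  where open IsGNS G

IsGNS-act : ∀ σ → IsGNS S → IsGNS (actSub σ S)
IsGNS-act {S = S} σ G = record
  { zero∈ = trans (cong S (reindex-𝟎 _)) zero∈
  ; closed = λ x y Sx Sy → trans (cong S (reindex-⊕ _ x y)) (closed _ _ Sx Sy)
  ; finiteHoles = map (actPt σ) (proj₁ finiteHoles) , Enumerates-act σ (proj₂ finiteHoles)
  }
  where open IsGNS G

IsGNS-Full : IsGNS (Full d)
IsGNS-Full = record
  { zero∈ = refl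
  ; closed = λ _ _ _ _ → refl
  ; finiteHoles = [] , λ _ → mk⇔ (λ ()) (λ ())
  }

HasGenus-resp : S ≐ T → HasGenus S g → HasGenus T g
HasGenus-resp S≐T (hs , en , u , len) = hs , Enumerates-resp S≐T en , u , len

HasGenus-act : ∀ σ → HasGenus S g → HasGenus (actSub σ S) g
HasGenus-act σ (hs , en , u , len) =
  map (actPt σ) hs , Enumerates-act σ en , Unique.map⁺ actPt-injective u , trans (length-map _ hs) len
  where
  actPt-injective : ∀ {x y} → actPt σ x ≡ actPt σ y → x ≡ y
  actPt-injective {x} {y} eq =
    trans (sym (actPt⁻¹-actPt σ x)) (trans (cong (actPt⁻¹ σ) eq) (actPt⁻¹-actPt σ y))

HasGenus-exists : IsGNS S → ∃ (HasGenus S)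
HasGenus-exists G = let hs , en = IsGNS.finiteHoles G in
  _ , deduplicate _≟ₚ_ hs , Enumerates-resp-∈ en (deduplicate-∈⇔ _≟ₚ_) , deduplicate-! _≟ₚ_ hs , refl

HasGenus-unique : HasGenus S g → HasGenus S k → g ≡ k
HasGenus-unique (hs , en , u , refl) (hs' , en' , u' , refl) = ↭-length (Enumerates-↭ en en' u u')

HasGenus-∪ : S f ≡ false → HasGenus (S ∪｛ f ｝) g → HasGenus S (suc g)
HasGenus-∪ Sf (hs , en , u , len) = _ , Enumerates-∷ Sf en , ¬Any⇒All¬ hs (hole-∉ en) ∷ u , cong suc len

HasGenus-∪⁻ : IsGNS (S ∪｛ f ｝) → S f ≡ false → HasGenus S (suc g) → HasGenus (S ∪｛ f ｝) g
HasGenus-∪⁻ G Sf gS with HasGenus-exists G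
... | _ , gS∪f with HasGenus-unique (HasGenus-∪ Sf gS∪f) gS
... | refl = gS∪f

HasGenus-zero⇔ : HasGenus S 0 ⇔ S ≐ Full d
HasGenus-zero⇔ {S = S} = mk⇔
  (λ where ([] , en , _ , _) x → ¬-not λ Sx → case to (en x) Sx of λ ())
  (λ S≐Full → [] , (λ x → mk⇔ (λ Sx → case trans (sym (S≐Full x)) Sx of λ ()) λ ()) , [] , refl)

Atom-adjoined : IsGNS T → T f ≡ false → S ≐ T ∪｛ f ｝ → Atom S f
Atom-adjoined {T = T} {f = f} {S = S} G Tf S≐ = (trans (S≐ f) (∪-self T f) , f≢𝟎) , not-sum
  where
  open IsGNS G
  f≢𝟎 : f ≢ 𝟎
  f≢𝟎 refl = case trans (sym zero∈) Tf of λ ()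
  in-T : ∀ {a} → Nonzero∈ S a → a ≢ f → T a ≡ true
  in-T (Sa , _) a≢f = trans (sym (∪-other T a≢f)) (trans (sym (S≐ _)) Sa)
  not-sum : ¬ (Σ _ λ a → Σ _ λ b → Nonzero∈ S a × Nonzero∈ S b × f ≡ a ⊕ b)
  not-sum (a , b , a∈@(_ , a≢𝟎) , b∈@(_ , b≢𝟎) , f≡a⊕b) =
    case trans (sym (closed a b (in-T a∈ a≢f) (in-T b∈ b≢f))) (subst (λ z → T z ≡ false) f≡a⊕b Tf)
    of λ ()
    where
    a≢f : a ≢ f
    a≢f refl = b≢𝟎 (⊕-cancelˡ a b (sym f≡a⊕b))
    b≢f : b ≢ f
    b≢f refl = a≢𝟎 (⊕-cancelˡ b a (trans (⊕-comm b a) (sym f≡a⊕b)))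

-- Semigroups ordered by a relaxed monomial order

module Ordered {d : ℕ} (O : RelaxedMonomialOrder d) where
  open RelaxedMonomialOrder O
  open WithOrder O
  open IsTotalOrder isTotalOrder using (antisym; total) renaming (refl to ≼-refl; trans to ≼-trans)

  ≼-decTotalOrder : DecTotalOrder _ _ _
  ≼-decTotalOrder = record
    { isDecTotalOrder = record
      { isTotalOrder = isTotalOrder
      ; _≟_ = _≟ₚ_
      ; _≤?_ = total∧dec⇒dec (λ { refl → ≼-refl }) antisym total _≟ₚ_
      }
    }

  open DecTotalOrder ≼-decTotalOrder using (totalOrder; _≤?_)
  open IsStrictTotalOrder (<-isStrictTotalOrder₁ _≡_ _≼_ _≟ₚ_ isTotalOrder)
    using (compare; irrefl; asym) renaming (trans to ≺-trans)
  open import Data.List.Extrema totalOrder using (max; ⊥≤max; xs≤max; argmax-sel)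
  open import Data.List.Sort.InsertionSort ≼-decTotalOrder using (insert; sort)
  open import Data.List.Sort.InsertionSort.Properties ≼-decTotalOrder
    using (insert-↗; insert-↭; sort-↗; sort-↭)
  open import Data.List.Relation.Unary.Sorted.TotalOrder totalOrder using (Sorted)
  open import Data.List.Relation.Unary.Sorted.TotalOrder.Properties using (↗↭↗⇒≋)
  open PermutationₛProperties (setoid (Pt d)) using (Unique-resp-↭)

  private variable
    m : Maybe (Pt d)
    F F' b : Pt d

  ≼-≺-trans : ∀ {x y z} → x ≼ y → y ≺ z → x ≺ z
  ≼-≺-trans x≼y (y≼z , y≢z) = ≼-trans x≼y y≼z , λ { refl → y≢z (antisym y≼z x≼y) }

  ≺-⊕ : ∀ x y → x ⊕ y ≢ x → x ≺ (x ⊕ y)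
  ≺-⊕ x y x⊕y≢x with total x (x ⊕ y)
  ... | inj₁ x≼x⊕y = x≼x⊕y , x⊕y≢x ∘ sym
  ... | inj₂ x⊕y≼x = ⊥-elim (irrefl refl (≺-compat (x ⊕ y) x y (x⊕y≼x , x⊕y≢x)))

  Isomorphic-sym : Isomorphic S T → Isomorphic T S
  Isomorphic-sym {S = S} (σ , T≐σS) =
    Perm.flip σ , λ x → sym (trans (T≐σS (actPt σ x)) (cong S (actPt⁻¹-actPt σ x)))

  HasGenus-iso : Isomorphic S T → HasGenus S g → HasGenus T g
  HasGenus-iso (σ , T≐σS) gS = HasGenus-resp (≐-sym T≐σS) (HasGenus-act σ gS)

  IsFrobenius-unique : IsFrobenius S (just F) → IsFrobenius S (just F') → F ≡ F'
  IsFrobenius-unique (SF , F-max) (SF' , F'-max) = antisym (F'-max _ SF) (F-max _ SF')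

  IsFrobenius-resp : S ≐ T → IsFrobenius S m → IsFrobenius T m
  IsFrobenius-resp {m = nothing} S≐T full x = trans (sym (S≐T x)) (full x)
  IsFrobenius-resp {m = just F} S≐T (SF , F-max) =
    trans (sym (S≐T F)) SF , λ h Th → F-max h (trans (S≐T h) Th)

  IsFrobenius-of-hole : ∀ {h} → Enumerates S (h ∷ hs) → ∃ λ F → IsFrobenius S (just F)
  IsFrobenius-of-hole {hs = hs} {h = h} en =
    max h hs , is-hole (argmax-sel id h hs) , λ x Sx → below (to (en x) Sx)
    where
    is-hole : max h hs ≡ h ⊎ max h hs ∈ hs → _
    is-hole (inj₁ eq) = from (en _) (here eq)
    is-hole (inj₂ max∈) = from (en _) (there max∈)
    below : ∀ {x} → x ∈ h ∷ hs → x ≼ max h hs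
    below (here refl) = ⊥≤max h hs
    below (there x∈) = All.lookup (xs≤max h hs) x∈

  IsFrobenius-exists : IsGNS S → ∃ (IsFrobenius S)
  IsFrobenius-exists G with IsGNS.finiteHoles G
  ... | [] , en = nothing , λ x → ¬-not λ Sx → case to (en x) Sx of λ ()
  ... | _ ∷ _ , en = Product.map just id (IsFrobenius-of-hole en)

  hole-≼ : ∀ {h} → IsFrobenius S m → m ≺ₘ n → S h ≡ false → h ≼ n
  hole-≼ {m = nothing} full _ Sh = case trans (sym (full _)) Sh of λ ()
  hole-≼ {m = just F} (_ , F-max) F≺n Sh = proj₁ (≼-≺-trans (F-max _ Sh) F≺n)

  above-Frobenius : ∀ {x} → IsFrobenius S (just F) → F ≺ x → S x ≡ true
  above-Frobenius (_ , F-max) F≺x = ¬-not λ Sx → irrefl refl (≼-≺-trans (F-max _ Sx) F≺x)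

  IsFrobenius-∖ : IsFrobenius S m → m ≺ₘ n → T ≐ S ∖｛ n ｝ → IsFrobenius T (just n)
  IsFrobenius-∖ {S = S} {n = n} frS m≺n T≐ = trans (T≐ n) (∖-self S n) , λ h Th → case h ≟ₚ n of λ where
    (yes refl) → ≼-refl
    (no h≢n) → hole-≼ frS m≺n (trans (sym (∖-other S h≢n)) (trans (sym (T≐ h)) Th))

  IsFrobenius-∪-≺ₘ : IsFrobenius T (just f) → S ≐ T ∪｛ f ｝ → IsFrobenius S m → m ≺ₘ f
  IsFrobenius-∪-≺ₘ {m = nothing} _ _ _ = tt
  IsFrobenius-∪-≺ₘ {T = T} {m = just h} (_ , f-max) S≐ (Sh , _) =
    let Th , h≢f = ∪-hole T (trans (sym (S≐ h)) Sh) in f-max h Th , h≢f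

  IsGNS-∪-Frobenius : IsGNS S → IsFrobenius S (just F) → IsGNS (S ∪｛ F ｝)
  IsGNS-∪-Frobenius {S = S} {F = F} G fr = record
    { zero∈ = ∪-⊇ S zero∈
    ; closed = closed′
    ; finiteHoles = _ , Enumerates-∪ (proj₂ finiteHoles)
    }
    where
    open IsGNS G
    F⊕-∈ : ∀ y → F ⊕ y ≢ F → S (F ⊕ y) ≡ true
    F⊕-∈ y F⊕y≢F = above-Frobenius fr (≺-⊕ F y F⊕y≢F)
    sum-∈ : ∀ x y → S x ≡ true ⊎ x ≡ F → S y ≡ true ⊎ y ≡ F → x ⊕ y ≢ F → S (x ⊕ y) ≡ true
    sum-∈ x y (inj₁ Sx) (inj₁ Sy) _ = closed x y Sx Sy
    sum-∈ x y (inj₂ refl) _ x⊕y≢F = F⊕-∈ y x⊕y≢F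
    sum-∈ x y (inj₁ _) (inj₂ refl) x⊕y≢F =
      subst (λ z → S z ≡ true) (⊕-comm F x) (F⊕-∈ x (x⊕y≢F ∘ trans (⊕-comm x F)))
    closed′ : ∀ x y → (S ∪｛ F ｝) x ≡ true → (S ∪｛ F ｝) y ≡ true → (S ∪｛ F ｝) (x ⊕ y) ≡ true
    closed′ x y S′x S′y = case (x ⊕ y) ≟ₚ F of λ where
      (yes x⊕y≡F) → subst (λ z → (S ∪｛ F ｝) z ≡ true) (sym x⊕y≡F) (∪-self S F)
      (no x⊕y≢F) → ∪-⊇ S (sum-∈ x y (∪-member S S′x) (∪-member S S′y) x⊕y≢F)

  strict⇒sorted : Linked _≺_ xs → Sorted xs
  strict⇒sorted = Linked.map proj₁

  strict⇒unique : Linked _≺_ xs → Unique xs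
  strict⇒unique s = AllPairs.map proj₂ (Linked⇒AllPairs ≺-trans s)

  sorted∧unique⇒strict : Sorted xs → Unique xs → Linked _≺_ xs
  sorted∧unique⇒strict s u = AllPairs⇒Linked (AllPairs.zip (Linked⇒AllPairs ≼-trans s , u))

  SortedHoles-resp : S ≐ T → SortedHoles S hs → SortedHoles T hs
  SortedHoles-resp S≐T (s , en) = s , Enumerates-resp S≐T en

  SortedHoles⇒HasGenus : SortedHoles S hs → HasGenus S (length hs)
  SortedHoles⇒HasGenus (s , en) = _ , en , strict⇒unique s , refl

  SortedHoles-↭ : Enumerates S xs → Unique xs → ys ↭ xs → Sorted ys → SortedHoles S ys
  SortedHoles-↭ en u ys↭xs s =
    sorted∧unique⇒strict s (Unique-resp-↭ (↭⇒↭ₛ (↭-sym ys↭xs)) u) , Enumerates-resp-↭ en (↭-sym ys↭xs)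

  SortedHoles-exists : IsGNS S → ∃ (SortedHoles S)
  SortedHoles-exists G =
    let _ , hs , en , u , _ = HasGenus-exists G in sort hs , SortedHoles-↭ en u (sort-↭ hs) (sort-↗ hs)

  SortedHoles-unique : SortedHoles S xs → SortedHoles S ys → xs ≡ ys
  SortedHoles-unique (sx , enx) (sy , eny) =
    Pointwise-≡⇒≡ (↗↭↗⇒≋ totalOrder (strict⇒sorted sx) (strict⇒sorted sy)
      (↭⇒↭ₛ (Enumerates-↭ enx eny (strict⇒unique sx) (strict⇒unique sy))))

  SortedHoles-insert : S b ≡ false → SortedHoles (S ∪｛ b ｝) hs → SortedHoles S (insert b hs)
  SortedHoles-insert {b = b} {hs = hs} Sb (s , en) = SortedHoles-↭ (Enumerates-∷ Sb en)
    (¬Any⇒All¬ hs (hole-∉ en) ∷ strict⇒unique s) (insert-↭ b hs) (insert-↗ b (strict⇒sorted s))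

  insert-last : ∀ hs → All (_≺ F) hs → insert F hs ≡ hs ∷ʳ F
  insert-last [] [] = refl
  insert-last {F = F} (a ∷ A) (a≺F ∷ A≺F) with F ≤? a
  ... | yes F≼a = ⊥-elim (irrefl refl (≼-≺-trans F≼a a≺F))
  ... | no _ = cong (a ∷_) (insert-last A A≺F)

  SortedHoles-∷ʳ-Frobenius : IsFrobenius S (just F) → SortedHoles (S ∪｛ F ｝) hs → SortedHoles S (hs ∷ʳ F)
  SortedHoles-∷ʳ-Frobenius {S = S} {hs = hs} (SF , F-max) h@(_ , en) =
    subst (SortedHoles S) (insert-last hs (All.tabulate below-F)) (SortedHoles-insert SF h)
    where
    below-F : ∀ {a} → a ∈ hs → a ≺ _
    below-F a∈ = let Sa , a≢F = ∪-hole S (from (en _) a∈) in F-max _ Sa , a≢F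

  LexLt-asym : LexLt xs ys → ¬ LexLt ys xs
  LexLt-asym (here x≺y) (here y≺x) = asym x≺y y≺x
  LexLt-asym (here x≺x) (there _) = irrefl refl x≺x
  LexLt-asym (there _) (here x≺x) = irrefl refl x≺x
  LexLt-asym (there xs<ys) (there ys<xs) = LexLt-asym xs<ys ys<xs

  LexLt-trichotomy : ∀ xs ys → length xs ≡ length ys → xs ≡ ys ⊎ LexLt xs ys ⊎ LexLt ys xs
  LexLt-trichotomy [] [] _ = inj₁ refl
  LexLt-trichotomy (x ∷ xs) (y ∷ ys) |xs|≡|ys| with compare x y
  ... | Tri.tri< x≺y _ _ = inj₂ (inj₁ (here x≺y))
  ... | Tri.tri> _ _ y≺x = inj₂ (inj₂ (here y≺x))
  ... | Tri.tri≈ _ refl _ = Sum.map (cong (x ∷_)) (Sum.map there there)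
    (LexLt-trichotomy xs ys (ℕ.suc-injective |xs|≡|ys|))

  LexLt-insert : ∀ zs → b ∉ ys → LexLt ys xs → LexLt (insert b ys) (xs ++ zs)
  LexLt-insert {b = b} {ys = y ∷ ys} zs b∉ ys<xs with b ≤? y | ys<xs
  ... | yes b≼y | here y≺x = here (≺-trans (b≼y , b∉ ∘ here) y≺x)
  ... | yes b≼y | there _ = here (b≼y , b∉ ∘ here)
  ... | no _ | here y≺x = here y≺x
  ... | no _ | there ys<xs′ = there (LexLt-insert zs (b∉ ∘ there) ys<xs′)

  ≼R-resp : S ≐ S' → T ≐ T' → S ≼R T → S' ≼R T'
  ≼R-resp S≐S' T≐T' (inj₁ S≐T) = inj₁ (≐-trans (≐-sym S≐S') (≐-trans S≐T T≐T'))
  ≼R-resp S≐S' T≐T' (inj₂ (hs , hs' , hS , hT , hs<hs')) =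
    inj₂ (hs , hs' , SortedHoles-resp S≐S' hS , SortedHoles-resp T≐T' hT , hs<hs')

  ≼R⇒¬LexLt : S ≼R T → SortedHoles S xs → SortedHoles T ys → ¬ LexLt ys xs
  ≼R⇒¬LexLt (inj₁ S≐T) hS hT ys<xs with SortedHoles-unique (SortedHoles-resp S≐T hS) hT
  ... | refl = LexLt-asym ys<xs ys<xs
  ≼R⇒¬LexLt (inj₂ (_ , _ , hS′ , hT′ , lt)) hS hT ys<xs
    with SortedHoles-unique hS′ hS | SortedHoles-unique hT′ hT
  ... | refl | refl = LexLt-asym lt ys<xs

  Rminimal : Subset d → Set
  Rminimal S = ∀ σ → S ≼R actSub σ S

  Rminimal-∪-Frobenius : IsGNS S → Rminimal S → IsFrobenius S (just F) → Rminimal (S ∪｛ F ｝)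
  Rminimal-∪-Frobenius {S = S} {F = F} G S-min fr σ = compare-holes (LexLt-trichotomy A B |A|≡|B|)
    where
    S′ = S ∪｛ F ｝
    G′ = IsGNS-∪-Frobenius G fr
    A = proj₁ (SortedHoles-exists G′)
    hA = proj₂ (SortedHoles-exists G′)
    B = proj₁ (SortedHoles-exists (IsGNS-act σ G′))
    hB = proj₂ (SortedHoles-exists (IsGNS-act σ G′))
    |A|≡|B| : length A ≡ length B
    |A|≡|B| = HasGenus-unique (HasGenus-act σ (SortedHoles⇒HasGenus hA)) (SortedHoles⇒HasGenus hB)
    hB′ : SortedHoles (actSub σ S ∪｛ actPt σ F ｝) B
    hB′ = SortedHoles-resp (actSub-∪ S σ F) hB
    σS-hole : actSub σ S (actPt σ F) ≡ false
    σS-hole = trans (cong S (actPt⁻¹-actPt σ F)) (proj₁ fr)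
    compare-holes : A ≡ B ⊎ LexLt A B ⊎ LexLt B A → S′ ≼R actSub σ S′
    compare-holes (inj₁ A≡B) = inj₁ (Enumerates-≐ (proj₂ hA) (subst (Enumerates _) (sym A≡B) (proj₂ hB)))
    compare-holes (inj₂ (inj₁ A<B)) = inj₂ (A , B , hA , hB , A<B)
    compare-holes (inj₂ (inj₂ B<A)) = ⊥-elim (≼R⇒¬LexLt (S-min σ)
      (SortedHoles-∷ʳ-Frobenius fr hA) (SortedHoles-insert σS-hole hB′)
      (LexLt-insert (F ∷ []) (hole-∉ (proj₂ hB′)) B<A))

  Rminimal⇒Vertex : IsGNS S → Rminimal S → Vertex S
  Rminimal⇒Vertex G S-min = _ , G , (Perm.id , actSub-id _) , S-min

  Vertex⇒IsGNS : Vertex T → IsGNS T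
  Vertex⇒IsGNS (_ , G , (τ , T≐τS) , _) = IsGNS-resp (≐-sym T≐τS) (IsGNS-act τ G)

  Vertex⇒Rminimal : Vertex T → Rminimal T
  Vertex⇒Rminimal {T = T} (S , _ , (τ , T≐τS) , T-min) σ =
    ≼R-resp ≐-refl (≐-sym (≐-trans (λ y → T≐τS (actPt⁻¹ σ y)) (actSub-∘ₚ S σ τ))) (T-min (τ Perm.∘ₚ σ))

  Vertex-resp : Vertex T → T ≐ T' → Vertex T'
  Vertex-resp (S , G , (τ , T≐τS) , T-min) T≐T' =
    S , G , (τ , ≐-trans (≐-sym T≐T') T≐τS) , λ σ → ≼R-resp T≐T' ≐-refl (T-min σ)

  Vertex-∪-Frobenius : Vertex S → IsFrobenius S (just F) → Vertex (S ∪｛ F ｝)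
  Vertex-∪-Frobenius vS fr = Rminimal⇒Vertex (IsGNS-∪-Frobenius (Vertex⇒IsGNS vS) fr)
    (Rminimal-∪-Frobenius (Vertex⇒IsGNS vS) (Vertex⇒Rminimal vS) fr)

  Vertex-Full : Vertex (Full d)
  Vertex-Full = Rminimal⇒Vertex IsGNS-Full λ _ → inj₁ ≐-refl

  -- The tree

  open Graph Vertex Edge

  Edge-deterministic : S ≐ S' → Edge S T → Edge S' T' → T ≐ T'
  Edge-deterministic S≐S' (_ , f , fr , T≐) (_ , f' , fr' , T'≐)
    with IsFrobenius-unique fr (IsFrobenius-resp (≐-sym S≐S') fr')
  ... | refl = λ x → trans (T≐ x) (trans (cong (_∨ ⌊ x ≟ₚ f ⌋) (S≐S' x)) (sym (T'≐ x)))

  walks-agree : S ≐ S' → (w : Walk S (Full d)) (w' : Walk S' (Full d)) →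
                Pointwise _≐_ (verts w) (verts w')
  walks-agree S≐S' (stop _ _) (stop _ _) = S≐S' ∷ []
  walks-agree S≐S' (stop _ S≐Full) (step _ (S'≢Full , _) _) =
    ⊥-elim (S'≢Full (≐-trans (≐-sym S≐S') S≐Full))
  walks-agree S≐S' (step _ (S≢Full , _) _) (stop _ S'≐Full) =
    ⊥-elim (S≢Full (≐-trans S≐S' S'≐Full))
  walks-agree S≐S' (step _ e w) (step _ e' w') = S≐S' ∷ walks-agree (Edge-deterministic S≐S' e e') w w'

  Walk-genus : (w : Walk S (Full d)) → HasGenus S (edges w)
  Walk-genus (stop _ S≐Full) = from HasGenus-zero⇔ S≐Full
  Walk-genus (step _ (_ , _ , (Sf , _) , T≐) w) = HasGenus-∪ Sf (HasGenus-resp T≐ (Walk-genus w))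

  Walk-⊇ : (w : Walk S T) → All (S ⊆ₛ_) (verts w)
  Walk-⊇ (stop _ _) = (λ _ → id) ∷ []
  Walk-⊇ {S = S} (step _ (_ , _ , _ , T≐) w) =
    (λ _ → id) ∷ All.map (λ T⊆V x Sx → T⊆V x (trans (T≐ x) (∪-⊇ S Sx))) (Walk-⊇ w)

  path-to-root : ∀ g → Vertex S → HasGenus S g → Path S (Full d)
  path-to-root zero vS gS = stop vS (to HasGenus-zero⇔ gS) , [] ∷ []
  path-to-root {S = S} (suc g) vS gS@(_ ∷ _ , en , _) with IsFrobenius-of-hole en
  ... | F , fr@(SF , _) = step vS edge w , All.map distinct (Walk-⊇ w) ∷ w-distinct
    where
    vS′ = Vertex-∪-Frobenius vS fr
    rest = path-to-root g vS′ (HasGenus-∪⁻ (Vertex⇒IsGNS vS′) SF gS)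
    w = proj₁ rest
    w-distinct = proj₂ rest
    edge : Edge S (S ∪｛ F ｝)
    edge = (λ S≐Full → case trans (sym (S≐Full F)) SF of λ ()) , F , fr , ≐-refl
    distinct : ∀ {V} → (S ∪｛ F ｝) ⊆ₛ V → ¬ S ≐ V
    distinct S′⊆V S≐V = case trans (sym (S′⊆V F (∪-self S F))) (trans (sym (S≐V F)) SF) of λ ()

  isTree : IsTreeWithRoot (Full d)
  isTree = Vertex-Full , λ S vS →
    path-to-root _ vS (proj₂ (HasGenus-exists (Vertex⇒IsGNS vS))) ,
    λ p q → walks-agree ≐-refl (proj₁ p) (proj₁ q)

  genus⇔depth : ∀ g S → InRSgd g S ⇔ (Vertex S × HasDepth (Full d) S g)
  genus⇔depth g S = mk⇔
    (λ where
      (S₀ , G , gS₀ , Rmin) →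
        let vS = S₀ , G , Rmin
            gS = HasGenus-iso (proj₁ Rmin) gS₀
            p = path-to-root g vS gS
        in vS , p , HasGenus-unique (Walk-genus (proj₁ p)) gS)
    (λ where
      ((S₀ , G , Rmin) , p , refl) →
        S₀ , G , HasGenus-iso (Isomorphic-sym (proj₁ Rmin)) (Walk-genus (proj₁ p)) , Rmin)

  children : ∀ S → Vertex S → ∀ T → (Vertex T × Edge T S)
    ⇔ (Σ (Pt d) λ n → InU S n × T ≐ (S ∖｛ n ｝) × InRSd (S ∖｛ n ｝))
  children S vS T = mk⇔
    (λ where
      (vT , _ , f , frT@(Tf , _) , S≐) →
        let m , frS = IsFrobenius-exists (Vertex⇒IsGNS vS)
            T≐ = ≐-∖-of-∪ Tf S≐
        in f , (Atom-adjoined (Vertex⇒IsGNS vT) Tf S≐ , m , frS , IsFrobenius-∪-≺ₘ frT S≐ frS)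
             , T≐ , Vertex-resp vT T≐)
    (λ where
      (n , (((Sn , _) , _) , _ , frS , m≺n) , T≐ , v∖n) →
        Vertex-resp v∖n (≐-sym T≐)
        , (λ T≐Full → case trans (sym (T≐Full n)) (trans (T≐ n) (∖-self S n)) of λ ())
        , n , IsFrobenius-∖ frS m≺n T≐ , ≐-∪-of-∖ Sn T≐)

mainTheorem4 : (d : ℕ) → 1 ≤ d → (O : RelaxedMonomialOrder d) →
    let open WithOrder O
        open Graph Vertex Edge
    in IsTreeWithRoot (Full d)
       × (∀ g → 1 ≤ g → ∀ S → InRSgd g S ⇔ (Vertex S × HasDepth (Full d) S g))
       × (∀ S → Vertex S → ∀ T →
           (Vertex T × Edge T S)
             ⇔ (Σ (Pt d) λ n → InU S n × T ≐ (S ∖｛ n ｝) × InRSd (S ∖｛ n ｝)))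
mainTheorem4 d _ O = isTree , (λ g _ → genus⇔depth g) , children
  where open Ordered O
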